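{- Let $d \geq 3$ and $n \geq 2$ be primes with $\gcd(d,n) = 1$. Let $u \in S_{d,n}$ and let $[a_1, \dots, a_r]$ be a partition of $u$. Then there is some $i \in \{1, \dots, r\}$ with $\gcd(a_i, nd) = 1$.
   Context: For integers $d, n \geq 2$, let $n^\ast \in \{1, \dots, d-1\}$ be the unique integer with $n^\ast \equiv -n \pmod d$, and $S_{d,n} := \{ n^\ast + jd : j \in \mathbb{Z}_{\geq 0},\ n^\ast + jd < n(d-1)\}$. A partition of a positive integer $u$ is a non-empty multiset $[a_1,\dots,a_r]$ of positive integers with $\sum_i a_i = u$. -}

module Defs where

open import Data.Nat using (ℕ; _+_; _*_; _∸_; _≤_; _<_)
open import Data.Nat.Divisibility using (_∣_)
open import Data.Product using (Σ; _×_; ∃)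
open import Data.List using (List; [])
open import Data.Nat.ListAction using (sum)
open import Data.List.Relation.Unary.All using (All)
open import Relation.Binary.PropositionalEquality using (_≡_; _≢_)

-- n* : an integer in {1, …, d-1} with n* ≡ -n (mod d), i.e. d ∣ n* + n.
IsNStar : ℕ → ℕ → ℕ → Set
IsNStar d n s = (1 ≤ s) × (s ≤ d ∸ 1) × (d ∣ s + n)

InS : ℕ → ℕ → ℕ → Set
InS d n u = Σ ℕ λ s → IsNStar d n s × (∃ λ j → u ≡ s + j * d) × (u < n * (d ∸ 1))

IsPartition : ℕ → List ℕ → Set
IsPartition u as = (as ≢ []) × All (λ a → 1 ≤ a) as × (sum as ≡ u)

{-# OPTIONS --safe #-}
-- If no part of the partition is coprime to nd, every part is a multiple of n or of d, so
-- u = nA + dB. Since u ≡ n* ≡ -n (mod d) and d is coprime to n, d divides A + 1; hence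
-- A ≥ d - 1 and u ≥ n(d - 1), contradicting u ∈ S_{d,n}.
module Submission where

open import Defs
open import Data.Nat using (ℕ; suc; _+_; _*_; _∸_; _≤_)
open import Data.Nat.Properties using (*-monoʳ-≤; ∸-monoˡ-≤; m≤m+n; ≤-trans; <⇒≱)
open import Data.Nat.Divisibility
  using (_∣_; _∤_; _∣?_; divides; ∣-trans; ∣⇒≤; m∣m*n; n∣m*n; ∣m+n∣m⇒∣n; ∣m∣n⇒∣m+n)
open import Data.Nat.Primality using (Prime; prime⇒irreducible)
open import Data.Nat.Coprimality using (Coprime; coprime-divisor)
open import Data.Nat.ListAction using (sum)
open import Data.Nat.Solver using (module +-*-Solver)
open import Data.List using (List)
open import Data.List.Relation.Unary.All as All using (All; []; _∷_)
open import Data.List.Relation.Unary.Any using (Any)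
open import Data.Product using (_,_; ∃₂)
open import Data.Sum using (_⊎_; inj₁; inj₂)
open import Data.Empty using (⊥-elim)
open import Relation.Nullary using (yes; no)
open import Relation.Binary.PropositionalEquality using (_≡_; refl; sym; trans; cong₂; subst)

open +-*-Solver using (solve; _:=_; _:+_; _:*_; con)

∤⇒coprime : ∀ {p a} → Prime p → p ∤ a → Coprime a p
∤⇒coprime pp p∤a (i∣a , i∣p) with prime⇒irreducible pp i∣p
... | inj₁ i≡1 = i≡1
... | inj₂ refl = ⊥-elim (p∤a i∣a)

coprime-* : ∀ {a m n} → Coprime a m → Coprime a n → Coprime a (m * n)
coprime-* a⊥m a⊥n (i∣a , i∣mn) =
  a⊥n (i∣a , coprime-divisor (λ (j∣i , j∣m) → a⊥m (∣-trans j∣i i∣a , j∣m)) i∣mn)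

∣⊎∣⊎coprime-* : ∀ {m n} → Prime m → Prime n → ∀ a → (m ∣ a ⊎ n ∣ a) ⊎ Coprime a (m * n)
∣⊎∣⊎coprime-* {m} {n} pm pn a with m ∣? a | n ∣? a
... | yes m∣a | _       = inj₁ (inj₁ m∣a)
... | no _    | yes n∣a = inj₁ (inj₂ n∣a)
... | no m∤a  | no n∤a  = inj₂ (coprime-* (∤⇒coprime pm m∤a) (∤⇒coprime pn n∤a))

sum-of-multiples : ∀ {m n} {as : List ℕ} → All (λ a → m ∣ a ⊎ n ∣ a) as →
  ∃₂ λ A B → sum as ≡ m * A + n * B
sum-of-multiples {m} {n} [] = 0 , 0 , solve 2 (λ m n → con 0 := m :* con 0 :+ n :* con 0) refl m n
sum-of-multiples {m} {n} (inj₁ (divides q a≡qm) ∷ ps) with sum-of-multiples ps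
... | A , B , s≡ = q + A , B , trans (cong₂ _+_ a≡qm s≡)
  (solve 5 (λ m n q A B → q :* m :+ (m :* A :+ n :* B) := m :* (q :+ A) :+ n :* B) refl m n q A B)
sum-of-multiples {m} {n} (inj₂ (divides q a≡qn) ∷ ps) with sum-of-multiples ps
... | A , B , s≡ = A , q + B , trans (cong₂ _+_ a≡qn s≡)
  (solve 5 (λ m n q A B → q :* n :+ (m :* A :+ n :* B) := m :* A :+ n :* (q :+ B)) refl m n q A B)

InS⇒∣+ : ∀ {d n u} → InS d n u → d ∣ u + n
InS⇒∣+ {d} {n} (s , (_ , _ , d∣s+n) , (j , refl) , _) =
  subst (d ∣_) (solve 4 (λ s n j d → s :+ n :+ j :* d := s :+ j :* d :+ n) refl s n j d)
    (∣m∣n⇒∣m+n d∣s+n (n∣m*n j))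

∣u+n⇒n*[d∸1]≤u : ∀ {d n u} A B → Coprime d n → u ≡ n * A + d * B → d ∣ u + n → n * (d ∸ 1) ≤ u
∣u+n⇒n*[d∸1]≤u {d} {n} A B d⊥n refl d∣u+n =
  ≤-trans (*-monoʳ-≤ n (∸-monoˡ-≤ 1 (∣⇒≤ d∣1+A))) (m≤m+n (n * A) (d * B))
  where
  d∣1+A : d ∣ suc A
  d∣1+A = coprime-divisor d⊥n (∣m+n∣m⇒∣n
    (subst (d ∣_) (solve 4 (λ n A d B → n :* A :+ d :* B :+ n := d :* B :+ n :* (con 1 :+ A)) refl n A d B) d∣u+n)
    (m∣m*n B))

lemma3p9 : (d n : ℕ) → Prime d → Prime n → 3 ≤ d → 2 ≤ n → Coprime d n →
    (u : ℕ) → InS d n u → (as : List ℕ) → IsPartition u as →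
    Any (λ a → Coprime a (n * d)) as
lemma3p9 d n pd pn _ _ d⊥n u u∈S@(_ , _ , _ , u<n*[d∸1]) as (_ , _ , Σas≡u)
  with All.decide (∣⊎∣⊎coprime-* pn pd) as
... | inj₂ coprime-part = coprime-part
... | inj₁ multiples with sum-of-multiples multiples
...   | A , B , Σas≡ = ⊥-elim (<⇒≱ u<n*[d∸1]
        (∣u+n⇒n*[d∸1]≤u A B d⊥n (trans (sym Σas≡u) Σas≡) (InS⇒∣+ u∈S)))
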